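{- For any logic $\mathsf{L}^{\mathsf{A}}$ as in the context, any constant specification $\mathsf{CS}$ and any formula $F\in\mathcal{L}^{\mathsf{A}}_J$: if $\mathsf{L}^{\mathsf{A}}_{\mathsf{CS}}\vdash F$ then $\mathcal{M},\omega\Vdash F$ for all $\mathsf{L}^{\mathsf{A}}_{\mathsf{CS}}$-subset models $\mathcal{M}=(W,W_0,V,E)$ and all $\omega\in W_0$.
   Context: Terms $\mathsf{Tm}^{\mathsf{A}}$: $t::=c_i\mid x_i\mid (t\cdot t)\mid(t+t)\mid\ !t$ ($c_i$ countably many constants, $x_i$ countably many variables). Formulas $\mathcal{L}^{\mathsf{A}}_J$: $F::=p_i\mid\bot\mid F\to F\mid t:F$. Axiom schemes: (cl) all classical propositional axioms; (j) $s:(A\to B)\to(t:A\to s\cdot t:B)$; (j+) $s:A\lor t:A\to(s+t):A$; (j4) $t:A\to\ !t:(t:A)$; (jd) $t:\bot\to\bot$; (jt) $t:A\to A$. A logic $\mathsf{L}^{\mathsf{A}}$ consists of (cl),(j),(j+) and some subset of $\{$(j4),(jd),(jt)$\}$. A constant specification $\mathsf{CS}$ is a set of pairs $(c,A)$, $c$ a constant, $A$ an axiom of $\mathsf{L}^{\mathsf{A}}$. $\mathsf{L}^{\mathsf{A}}_{\mathsf{CS}}$ is the Hilbert system with these axioms, modus ponens and axiom necessitation (for $(c,A)\in\mathsf{CS}$, $n\ge0$ infer $!^nc:\,!^{n-1}c:\cdots:\,!c:c:A$, $!^kc$ being $c$ preceded by $k$ copies of $!$). An $\mathsf{L}^{\mathsf{A}}_{\mathsf{CS}}$-subset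 model is $\mathcal{M}=(W,W_0,V,E)$ with $W$ a set, $\emptyset\ne W_0\subseteq W$, $V:W\times\mathcal{L}^{\mathsf{A}}_J\to\{0,1\}$, $E:W\times\mathsf{Tm}^{\mathsf{A}}\to\mathcal{P}(W)$ such that, with $[A]=\{\upsilon:V(\upsilon,A)=1\}$ and $\mathsf{APP}_\omega(s,t)=\{F:\exists H\,(E(\omega,s)\subseteq[H\to F]$ and $E(\omega,t)\subseteq[H])\}$, for all $\omega\in W_0$, $s,t\in\mathsf{Tm}^{\mathsf{A}}$, $F,G$: $V(\omega,\bot)=0$; $V(\omega,F\to G)=1$ iff $V(\omega,F)=0$ or $V(\omega,G)=1$; $V(\omega,t:F)=1$ iff $E(\omega,t)\subseteq[F]$; $E(\omega,s\cdot t)\subseteq\{\upsilon\in W:\upsilon\in[F]$ for all $F\in\mathsf{APP}_\omega(s,t)\}$; $E(\omega,s+t)\subseteq E(\omega,s)\cap E(\omega,t)$; if (jd)$\in\mathsf{L}^{\mathsf{A}}$ some $\upsilon\in W_0$ is in $E(\omega,t)$; if (jt)$\in\mathsf{L}^{\mathsf{A}}$ then $\omega\in E(\omega,t)$; if (j4)$\in\mathsf{L}^{\mathsf{A}}$ then $E(\omega,!t)\subseteq\{\upsilon:\forall F\,(V(\omega,t:F)=1\Rightarrow V(\upsilon,t:F)=1)\}$; for $(c,A)\in\mathsf{CS}$, $n\ge1$: $E(\omega,c)\subseteq[A]$ and $E(\omega,!^nc)\subseteq[!^{n-1}c:\cdots:\,!c:c:A]$. Truth: $\mathcal{M},\omega\Vdash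 F$ iff $V(\omega,F)=1$. -}

module Defs where

open import Data.Nat using (ℕ; zero; suc)
open import Data.Bool using (Bool; true; false; not; _∨_)
open import Data.Product using (Σ; _×_)
open import Relation.Binary.PropositionalEquality using (_≡_)

data Tm : Set where
  c   : ℕ → Tm
  x   : ℕ → Tm
  _·_ : Tm → Tm → Tm
  _⊕_ : Tm → Tm → Tm
  !_  : Tm → Tm

infixr 5 _⇒_
infix 6 _∶_
data Fm : Set where
  p   : ℕ → Fm
  ⊥'  : Fm
  _⇒_ : Fm → Fm → Fm
  _∶_ : Tm → Fm → Fm

¬' : Fm → Fm
¬' A = A ⇒ ⊥'

_∨'_ : Fm → Fm → Fm
A ∨' B = ¬' A ⇒ B

-- classical propositional axioms: all propositional tautologies, where
-- p_i and t:F are treated as propositional atoms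
evalProp : (Fm → Bool) → Fm → Bool
evalProp v (p i)   = v (p i)
evalProp v ⊥'      = false
evalProp v (A ⇒ B) = not (evalProp v A) ∨ evalProp v B
evalProp v (t ∶ A) = v (t ∶ A)

Tautology : Fm → Set
Tautology A = (v : Fm → Bool) → evalProp v A ≡ true

record Logic : Set where
  field
    hasJ4 : Bool
    hasJD : Bool
    hasJT : Bool
open Logic public

data Axiom (L : Logic) : Fm → Set where
  cl  : ∀ {A} → Tautology A → Axiom L A
  j   : ∀ s t A B → Axiom L ((s ∶ (A ⇒ B)) ⇒ (t ∶ A ⇒ (s · t) ∶ B))
  j+  : ∀ s t A → Axiom L (((s ∶ A) ∨' (t ∶ A)) ⇒ (s ⊕ t) ∶ A)
  j4  : hasJ4 L ≡ true → ∀ t A → Axiom L (t ∶ A ⇒ (! t) ∶ (t ∶ A))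
  jd  : hasJD L ≡ true → ∀ t → Axiom L (t ∶ ⊥' ⇒ ⊥')
  jt  : hasJT L ≡ true → ∀ t A → Axiom L (t ∶ A ⇒ A)

record CSpec (L : Logic) : Set₁ where
  field
    CS     : ℕ → Fm → Set
    CS-ax  : ∀ {i A} → CS i A → Axiom L A
open CSpec public

!^ : ℕ → Tm → Tm
!^ zero    t = t
!^ (suc k) t = ! (!^ k t)

necForm : ℕ → Fm → ℕ → Fm
necForm i A zero    = c i ∶ A
necForm i A (suc n) = !^ (suc n) (c i) ∶ necForm i A n

data Prf (L : Logic) (CS' : CSpec L) : Fm → Set where
  ax  : ∀ {A} → Axiom L A → Prf L CS' A
  mp  : ∀ {A B} → Prf L CS' (A ⇒ B) → Prf L CS' A → Prf L CS' B
  an  : ∀ {i A} → CS CS' i A → (n : ℕ) → Prf L CS' (necForm i A n)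

record SubsetModel (L : Logic) (CS' : CSpec L) : Set₁ where
  field
    W   : Set
    W₀  : W → Set
    W₀-nonempty : Σ W W₀
    V   : W → Fm → Bool
    E   : W → Tm → W → Set
  ⟦_⟧ : Fm → W → Set
  ⟦ A ⟧ υ = V υ A ≡ true
  _⊆_ : (W → Set) → (W → Set) → Set
  P ⊆ Q = ∀ υ → P υ → Q υ
  APP : W → Tm → Tm → Fm → Set
  APP ω s t F = Σ Fm (λ H → (E ω s ⊆ ⟦ H ⇒ F ⟧) × (E ω t ⊆ ⟦ H ⟧))
  field
    V-⊥  : ∀ ω → W₀ ω → V ω ⊥' ≡ false
    V-⇒  : ∀ ω → W₀ ω → ∀ F G → V ω (F ⇒ G) ≡ not (V ω F) ∨ V ω G
    V-∶₁ : ∀ ω → W₀ ω → ∀ t F → V ω (t ∶ F) ≡ true → E ω t ⊆ ⟦ F ⟧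
    V-∶₂ : ∀ ω → W₀ ω → ∀ t F → E ω t ⊆ ⟦ F ⟧ → V ω (t ∶ F) ≡ true
    E-·  : ∀ ω → W₀ ω → ∀ s t → E ω (s · t) ⊆ (λ υ → ∀ F → APP ω s t F → ⟦ F ⟧ υ)
    E-⊕  : ∀ ω → W₀ ω → ∀ s t → E ω (s ⊕ t) ⊆ (λ υ → E ω s υ × E ω t υ)
    E-jd : hasJD L ≡ true → ∀ ω → W₀ ω → ∀ t → Σ W (λ υ → W₀ υ × E ω t υ)
    E-jt : hasJT L ≡ true → ∀ ω → W₀ ω → ∀ t → E ω t ω
    E-j4 : hasJ4 L ≡ true → ∀ ω → W₀ ω → ∀ t →
             E ω (! t) ⊆ (λ υ → ∀ F → V ω (t ∶ F) ≡ true → V υ (t ∶ F) ≡ true)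
    E-CS₀ : ∀ ω → W₀ ω → ∀ {i A} → CS CS' i A → E ω (c i) ⊆ ⟦ A ⟧
    E-CS  : ∀ ω → W₀ ω → ∀ {i A} → CS CS' i A → (n : ℕ) →
              E ω (!^ (suc n) (c i)) ⊆ ⟦ necForm i A n ⟧
open SubsetModel public

_,_⊩_ : ∀ {L CS'} (M : SubsetModel L CS') → W M → Fm → Set
M , ω ⊩ F = V M ω F ≡ true

module Submission where

open import Defs
open import Data.Bool using (Bool; true; false; not; _∨_)
open import Data.Empty using (⊥-elim)
open import Data.Nat using (zero; suc)
open import Data.Product using (_,_; proj₁; proj₂)
open import Data.Sum using (_⊎_; inj₁; inj₂; [_,_])
open import Relation.Binary.PropositionalEquality using (_≡_; _≢_; refl; sym; trans; cong₂)

true≢false : true ≢ false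
true≢false ()

not∨-intro : ∀ {a b : Bool} → (a ≡ true → b ≡ true) → not a ∨ b ≡ true
not∨-intro {false} _ = refl
not∨-intro {true}  f = f refl

not∨-elim : ∀ {a b : Bool} → not a ∨ b ≡ true → a ≡ true → b ≡ true
not∨-elim h refl = h

-- All clauses of a subset model constrain only normal worlds, so soundness is
-- proved at a fixed ω ∈ W₀.
module Soundness {L : Logic} {CS' : CSpec L} (M : SubsetModel L CS')
                 {ω : W M} (ω∈W₀ : W₀ M ω) where

  ⇒-intro : ∀ {F G} → (M , ω ⊩ F → M , ω ⊩ G) → M , ω ⊩ (F ⇒ G)
  ⇒-intro {F} {G} f = trans (V-⇒ M ω ω∈W₀ F G) (not∨-intro f)

  ⇒-elim : ∀ {F G} → M , ω ⊩ (F ⇒ G) → M , ω ⊩ F → M , ω ⊩ G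
  ⇒-elim {F} {G} h = not∨-elim (trans (sym (V-⇒ M ω ω∈W₀ F G)) h)

  ∨'-elim : ∀ {F G} → M , ω ⊩ (F ∨' G) → M , ω ⊩ F ⊎ M , ω ⊩ G
  ∨'-elim {F} h with V M ω F in eq
  ... | true  = inj₁ refl
  ... | false = inj₂ (⇒-elim h (⇒-intro λ F-true → ⊥-elim (true≢false (trans (sym F-true) eq))))

  evalProp-V : ∀ A → evalProp (V M ω) A ≡ V M ω A
  evalProp-V (p i)   = refl
  evalProp-V ⊥'      = sym (V-⊥ M ω ω∈W₀)
  evalProp-V (A ⇒ B) =
    trans (cong₂ (λ a b → not a ∨ b) (evalProp-V A) (evalProp-V B)) (sym (V-⇒ M ω ω∈W₀ A B))
  evalProp-V (t ∶ A) = refl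

  tautology-sound : ∀ {A} → Tautology A → M , ω ⊩ A
  tautology-sound {A} taut = trans (sym (evalProp-V A)) (taut (V M ω))

  j-sound : ∀ s t A B → M , ω ⊩ (s ∶ (A ⇒ B) ⇒ t ∶ A ⇒ (s · t) ∶ B)
  j-sound s t A B = ⇒-intro λ s∶A⇒B → ⇒-intro λ t∶A →
    V-∶₂ M ω ω∈W₀ (s · t) B λ υ υ∈E →
      E-· M ω ω∈W₀ s t υ υ∈E B (A , V-∶₁ M ω ω∈W₀ s (A ⇒ B) s∶A⇒B , V-∶₁ M ω ω∈W₀ t A t∶A)

  j+-sound : ∀ s t A → M , ω ⊩ (((s ∶ A) ∨' (t ∶ A)) ⇒ (s ⊕ t) ∶ A)
  j+-sound s t A = ⇒-intro λ s∶A∨t∶A → V-∶₂ M ω ω∈W₀ (s ⊕ t) A λ υ υ∈E →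
    [ (λ s∶A → V-∶₁ M ω ω∈W₀ s A s∶A υ (proj₁ (E-⊕ M ω ω∈W₀ s t υ υ∈E)))
    , (λ t∶A → V-∶₁ M ω ω∈W₀ t A t∶A υ (proj₂ (E-⊕ M ω ω∈W₀ s t υ υ∈E)))
    ] (∨'-elim s∶A∨t∶A)

  j4-sound : hasJ4 L ≡ true → ∀ t A → M , ω ⊩ (t ∶ A ⇒ (! t) ∶ (t ∶ A))
  j4-sound j4∈L t A = ⇒-intro λ t∶A →
    V-∶₂ M ω ω∈W₀ (! t) (t ∶ A) λ υ υ∈E → E-j4 M j4∈L ω ω∈W₀ t υ υ∈E A t∶A

  jd-sound : hasJD L ≡ true → ∀ t → M , ω ⊩ (t ∶ ⊥' ⇒ ⊥')
  jd-sound jd∈L t = ⇒-intro λ t∶⊥ →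
    let (υ , υ∈W₀ , υ∈E) = E-jd M jd∈L ω ω∈W₀ t
    in ⊥-elim (true≢false (trans (sym (V-∶₁ M ω ω∈W₀ t ⊥' t∶⊥ υ υ∈E)) (V-⊥ M υ υ∈W₀)))

  jt-sound : hasJT L ≡ true → ∀ t A → M , ω ⊩ (t ∶ A ⇒ A)
  jt-sound jt∈L t A = ⇒-intro λ t∶A → V-∶₁ M ω ω∈W₀ t A t∶A ω (E-jt M jt∈L ω ω∈W₀ t)

  axiom-sound : ∀ {A} → Axiom L A → M , ω ⊩ A
  axiom-sound (cl taut)      = tautology-sound taut
  axiom-sound (j s t A B)    = j-sound s t A B
  axiom-sound (j+ s t A)     = j+-sound s t A
  axiom-sound (j4 j4∈L t A)  = j4-sound j4∈L t A
  axiom-sound (jd jd∈L t)    = jd-sound jd∈L t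
  axiom-sound (jt jt∈L t A)  = jt-sound jt∈L t A

  necForm-sound : ∀ {i A} → CS CS' i A → ∀ n → M , ω ⊩ necForm i A n
  necForm-sound {i} {A} cs zero    = V-∶₂ M ω ω∈W₀ (c i) A (E-CS₀ M ω ω∈W₀ cs)
  necForm-sound {i} {A} cs (suc n) = V-∶₂ M ω ω∈W₀ _ (necForm i A n) (E-CS M ω ω∈W₀ cs n)

  sound : ∀ {F} → Prf L CS' F → M , ω ⊩ F
  sound (ax a)    = axiom-sound a
  sound (mp d e)  = ⇒-elim (sound d) (sound e)
  sound (an cs n) = necForm-sound cs n

mainTheorem7 : (L : Logic) (CS' : CSpec L) (F : Fm) → Prf L CS' F →
    (M : SubsetModel L CS') (ω : W M) → W₀ M ω → M , ω ⊩ F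
mainTheorem7 L CS' F d M ω ω∈W₀ = Soundness.sound M ω∈W₀ d
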